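{- Let $k\geq 3$ and suppose there exists a Steiner system $S(k-1,k,n)$ on the point set $[n]$ with $n\geq 4k-2$. Then its blocks form a resolving set for the Kneser graph $K(n,k)$, and consequently \[ \beta(K(n,k))\leq \frac{1}{k}\binom{n}{k-1}. \]
   Context: For integers $n>k>t>1$, a Steiner system $S(t,k,n)$ is a family of $k$-subsets (blocks) of $[n]=\{1,\dots,n\}$ such that every $t$-subset of $[n]$ is contained in exactly one block. The Kneser graph $K(n,k)$ has as vertices the $k$-subsets of $[n]$, adjacent when disjoint. A resolving set is a set $\mathcal{S}$ of vertices such that for all distinct vertices $U,W$ some $X\in\mathcal{S}$ has $d(U,X)\neq d(W,X)$; $\beta$ is the minimum size of a resolving set. -}

module Defs where

open import Data.Nat using (ℕ; zero; suc; _<_)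
open import Data.Fin.Subset using (Subset; ∣_∣; _∩_; Empty; _⊆_)
open import Data.List using (List)
open import Data.List.Membership.Propositional using (_∈_)
open import Data.List.Relation.Unary.Unique.Propositional using (Unique)
open import Data.List.Relation.Unary.All using (All)
open import Data.Product using (Σ; ∃; _×_)
open import Relation.Binary.PropositionalEquality using (_≡_; _≢_)
open import Relation.Nullary using (¬_)

-- Subsets of [n] are represented by Data.Fin.Subset n (points 0..n-1).

IsKSubset : ∀ {n} → ℕ → Subset n → Set
IsKSubset k U = ∣ U ∣ ≡ k

record IsSteiner (t k n : ℕ) (B : List (Subset n)) : Set where
  field
    distinct  : Unique B
    blockSize : All (IsKSubset k) B
    covers    : ∀ (T : Subset n) → IsKSubset t T →
                ∃ λ X → X ∈ B × T ⊆ X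
    unique    : ∀ (T : Subset n) → IsKSubset t T →
                ∀ X Y → X ∈ B → Y ∈ B → T ⊆ X → T ⊆ Y → X ≡ Y

KAdj : ∀ {n} → ℕ → Subset n → Subset n → Set
KAdj k U V = IsKSubset k U × IsKSubset k V × Empty (U ∩ V)

data Walk {n : ℕ} (k : ℕ) : Subset n → Subset n → ℕ → Set where
  here : ∀ {U} → Walk k U U zero
  step : ∀ {U V X m} → KAdj k U V → Walk k V X m → Walk k U X (suc m)

Dist : ∀ {n} → ℕ → Subset n → Subset n → ℕ → Set
Dist k U X d = Walk k U X d × (∀ m → m < d → ¬ Walk k U X m)

IsResolving : ∀ {n} → ℕ → List (Subset n) → Set
IsResolving {n} k S =
  Unique S × All (IsKSubset k) S ×
  (∀ (U W : Subset n) → IsKSubset k U → IsKSubset k W → U ≢ W →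
     ∃ λ X → X ∈ S × ∃ λ a → ∃ λ b → Dist k U X a × Dist k W X b × a ≢ b)

IsMetricDim : ℕ → ℕ → ℕ → Set
IsMetricDim n k b =
  (∃ λ (S : List (Subset n)) → IsResolving k S × Data.List.length S ≡ b) ×
  (∀ (S : List (Subset n)) → IsResolving k S → b Data.Nat.≤ Data.List.length S)

-- The key fact (`separating-block`) is that for every k-set W and
-- point x ∉ W some block contains x and misses W.  Fix x plus k-3 further
-- points outside W (a (k-2)-set S) and k+1 points outside W ∪ S.  The blocks
-- through S ∪ {y} pairwise share no point of W, since two sharing w would both
-- be the block through S ∪ {w} and so contain k+1 points; a pigeonhole count
-- of their traces on W (`traces-bound`) leaves one of them disjoint from W.
-- When 3k ≤ n all distances in K(n,k) are 0, 1 or 2, so for U ≠ W and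
-- x ∈ U \ W that block X has d(W,X) = 1 ≠ d(U,X).
--
-- The shadows (sets of (k-1)-subsets) of distinct blocks are
-- disjoint, and a family of distinct (k-1)-subsets of [n] has at most C(n,k-1)
-- members (Pascal's rule), so k·|B| ≤ C(n,k-1) (`steiner-bound`).
module Submission where

open import Data.Bool using (Bool; true; false)
open import Data.Empty using (⊥; ⊥-elim)
open import Data.Fin as Fin using (Fin)
import Data.Fin.Properties as Fin
open import Data.Fin.Subset
  using (Subset; ∣_∣; _∩_; _∪_; ∁; ⁅_⁆; _-_; _∈_; _∉_; _⊆_; Empty; Nonempty)
  renaming (⊥ to ∅)
open import Data.Fin.Subset.Properties
  using (x∈p∪q⁺; x∈p∪q⁻; x∈⁅x⁆; x∈⁅y⁆⇒x≡y; ∉⊥; ∣⊥∣≡0; ∣∁p∣≡n∸∣p∣; x∈∁p⇒x∉p;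
         x∈p∩q⁺; x∈p∩q⁻; x∈p∧x≢y⇒x∈p-y; x∈p⇒∣p-x∣<∣p∣;
         nonempty?; Empty-unique; ∩-idem; p─q⊆p; ∣⁅x⁆∣≡1;
         out⊆; s⊆s; ⊆-refl)
import Data.Bool.Properties as Bool
open import Data.List using (List; []; _∷_; length; map; concatMap; _++_)
open import Data.List.Membership.Propositional using (find) renaming (_∈_ to _∈ₗ_; _∉_ to _∉ₗ_)
open import Data.List.Relation.Unary.Any as Any using (Any; any?)
open import Data.List.Relation.Unary.All as All using (All; []; _∷_)
open import Data.List.Relation.Unary.All.Properties.Core using (¬Any⇒All¬; All¬⇒¬Any)
open import Data.List.Relation.Unary.All.Properties using (map⁺)
open import Data.List.Relation.Unary.AllPairs using ([]; _∷_)
open import Data.List.Relation.Unary.Unique.Propositional using (Unique)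
import Data.List.Relation.Unary.Unique.Propositional.Properties as Unique
open import Data.List.Properties using (length-map; length-++)
open import Data.List.Membership.Propositional.Properties using (∈-concatMap⁻)
open import Data.Nat using (ℕ; zero; suc; _+_; _*_; _∸_; _≤_; z≤n; s≤s)
open import Data.Nat.Properties
open import Data.Nat.Tactic.RingSolver using (solve-∀)
open import Data.Nat.Combinatorics using (_C_; nCk+nC[k+1]≡[n+1]C[k+1])
open import Data.Vec.Properties using (≡-dec; ∷-injectiveʳ)
open import Data.Product using (∃; _×_; _,_; proj₁; proj₂)
open import Data.Sum using (_⊎_; inj₁; inj₂)
open import Data.Vec.Base using (here; there; []; _∷_)
open import Relation.Binary.PropositionalEquality
open import Relation.Nullary using (Dec; yes; no; ¬?; contradiction)
open import Relation.Nullary.Decidable using (decidable-stable)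

open import Defs

unique-∷ : ∀ {A : Set} {x : A} {xs} → x ∉ₗ xs → Unique xs → Unique (x ∷ xs)
unique-∷ {xs = xs} x∉xs u = ¬Any⇒All¬ xs x∉xs ∷ u

unique-head : ∀ {A : Set} {x : A} {xs} → Unique (x ∷ xs) → x ∉ₗ xs
unique-head (x≢xs ∷ _) = All¬⇒¬Any x≢xs

-- Pigeonhole for traces on W: if the sets F y, for distinct y ∈ ys, all meet W
-- and no point of W lies in two of them, then ys has at most |W| entries.
-- (Remove from W the point where the first set meets it and recurse.)
traces-bound : ∀ {n} {A : Set} (F : A → Subset n) (W : Subset n) (ys : List A) →
  Unique ys → All (λ y → Nonempty (W ∩ F y)) ys →
  (∀ {y y' w} → y ∈ₗ ys → y' ∈ₗ ys → y ≢ y' → w ∈ W → w ∈ F y → w ∈ F y' → ⊥) →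
  length ys ≤ ∣ W ∣
traces-bound F W [] _ _ _ = z≤n
traces-bound F W (y ∷ ys) u@(_ ∷ uys) ((w , w∈W∩Fy) ∷ meets) separated =
  ≤-trans (s≤s (traces-bound F (W - w) ys uys meets-W-w separated-W-w)) (x∈p⇒∣p-x∣<∣p∣ w∈W)
  where
  w∈W : w ∈ W
  w∈W = proj₁ (x∈p∩q⁻ W (F y) w∈W∩Fy)
  w∈F-y : w ∈ F y
  w∈F-y = proj₂ (x∈p∩q⁻ W (F y) w∈W∩Fy)
  y≢ : ∀ {y'} → y' ∈ₗ ys → y ≢ y'
  y≢ y'∈ys refl = unique-head u y'∈ys
  meets-W-w : All (λ y' → Nonempty ((W - w) ∩ F y')) ys
  meets-W-w = All.tabulate λ {y'} y'∈ys →
    let (v , v∈W∩Fy') = All.lookup meets y'∈ys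
        (v∈W , v∈Fy') = x∈p∩q⁻ W (F y') v∈W∩Fy'
        v≢w : v ≢ w
        v≢w = λ { refl → separated (Any.here refl) (Any.there y'∈ys) (y≢ y'∈ys) w∈W w∈F-y v∈Fy' }
    in v , x∈p∩q⁺ (x∈p∧x≢y⇒x∈p-y v∈W v≢w , v∈Fy')
  separated-W-w : ∀ {y₁ y₂ v} → y₁ ∈ₗ ys → y₂ ∈ₗ ys → y₁ ≢ y₂ → v ∈ W - w → v ∈ F y₁ → v ∈ F y₂ → ⊥
  separated-W-w y₁∈ y₂∈ y₁≢y₂ v∈W-w =
    separated (Any.there y₁∈) (Any.there y₂∈) y₁≢y₂ (p─q⊆p W ⁅ w ⁆ v∈W-w)

distinct-length≤ : ∀ {n} {p : Subset n} (xs : List (Fin n)) →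
  Unique xs → All (_∈ p) xs → length xs ≤ ∣ p ∣
distinct-length≤ {p = p} xs u xs⊆p =
  traces-bound ⁅_⁆ p xs u (All.map (λ {y} y∈p → y , x∈p∩q⁺ (y∈p , x∈⁅x⁆ y)) xs⊆p)
    λ {y} {y'} _ _ y≢y' _ w∈⁅y⁆ w∈⁅y'⁆ →
      y≢y' (trans (sym (x∈⁅y⁆⇒x≡y y w∈⁅y⁆)) (x∈⁅y⁆⇒x≡y y' w∈⁅y'⁆))

∣p∪q∣≤∣p∣+∣q∣ : ∀ {n} (p q : Subset n) → ∣ p ∪ q ∣ ≤ ∣ p ∣ + ∣ q ∣
∣p∪q∣≤∣p∣+∣q∣ [] [] = z≤n
∣p∪q∣≤∣p∣+∣q∣ (true ∷ p) (true ∷ q) =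
  s≤s (≤-trans (∣p∪q∣≤∣p∣+∣q∣ p q) (≤-trans (n≤1+n _) (≤-reflexive (sym (+-suc ∣ p ∣ ∣ q ∣)))))
∣p∪q∣≤∣p∣+∣q∣ (true ∷ p) (false ∷ q) = s≤s (∣p∪q∣≤∣p∣+∣q∣ p q)
∣p∪q∣≤∣p∣+∣q∣ (false ∷ p) (true ∷ q) =
  ≤-trans (s≤s (∣p∪q∣≤∣p∣+∣q∣ p q)) (≤-reflexive (sym (+-suc ∣ p ∣ ∣ q ∣)))
∣p∪q∣≤∣p∣+∣q∣ (false ∷ p) (false ∷ q) = ∣p∪q∣≤∣p∣+∣q∣ p q

∣⁅x⁆∪p∣≡1+∣p∣ : ∀ {n} (x : Fin n) (p : Subset n) → x ∉ p → ∣ ⁅ x ⁆ ∪ p ∣ ≡ suc ∣ p ∣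
∣⁅x⁆∪p∣≡1+∣p∣ Fin.zero    (true ∷ p)  x∉p = ⊥-elim (x∉p here)
∣⁅x⁆∪p∣≡1+∣p∣ Fin.zero    (false ∷ p) _   = cong (λ q → suc ∣ q ∣) (∅∪p≡p p)
  where
  ∅∪p≡p : ∀ {m} (q : Subset m) → ∅ ∪ q ≡ q
  ∅∪p≡p [] = refl
  ∅∪p≡p (b ∷ q) = cong (b ∷_) (∅∪p≡p q)
∣⁅x⁆∪p∣≡1+∣p∣ (Fin.suc x) (true ∷ p)  x∉p = cong suc (∣⁅x⁆∪p∣≡1+∣p∣ x p (λ x∈p → x∉p (there x∈p)))
∣⁅x⁆∪p∣≡1+∣p∣ (Fin.suc x) (false ∷ p) x∉p = ∣⁅x⁆∪p∣≡1+∣p∣ x p (λ x∈p → x∉p (there x∈p))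

⟦_⟧ : ∀ {n} → List (Fin n) → Subset n
⟦ [] ⟧     = ∅
⟦ x ∷ xs ⟧ = ⁅ x ⁆ ∪ ⟦ xs ⟧

∈⟦⟧⁺ : ∀ {n} {x : Fin n} xs → x ∈ₗ xs → x ∈ ⟦ xs ⟧
∈⟦⟧⁺ (y ∷ xs) (Any.here refl) = x∈p∪q⁺ (inj₁ (x∈⁅x⁆ y))
∈⟦⟧⁺ (y ∷ xs) (Any.there x∈xs) = x∈p∪q⁺ (inj₂ (∈⟦⟧⁺ xs x∈xs))

∈⟦⟧⁻ : ∀ {n} {x : Fin n} xs → x ∈ ⟦ xs ⟧ → x ∈ₗ xs
∈⟦⟧⁻ [] x∈∅ = ⊥-elim (∉⊥ x∈∅)
∈⟦⟧⁻ (y ∷ xs) x∈ with x∈p∪q⁻ ⁅ y ⁆ ⟦ xs ⟧ x∈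
... | inj₁ x∈⁅y⁆ = Any.here (x∈⁅y⁆⇒x≡y y x∈⁅y⁆)
... | inj₂ x∈xs  = Any.there (∈⟦⟧⁻ xs x∈xs)

∣⟦⟧∣ : ∀ {n} (xs : List (Fin n)) → Unique xs → ∣ ⟦ xs ⟧ ∣ ≡ length xs
∣⟦⟧∣ {n} [] _ = ∣⊥∣≡0 n
∣⟦⟧∣ (x ∷ xs) u@(_ ∷ uxs) = begin
  ∣ ⁅ x ⁆ ∪ ⟦ xs ⟧ ∣ ≡⟨ ∣⁅x⁆∪p∣≡1+∣p∣ x ⟦ xs ⟧ (λ x∈ → unique-head u (∈⟦⟧⁻ xs x∈)) ⟩
  suc ∣ ⟦ xs ⟧ ∣     ≡⟨ cong suc (∣⟦⟧∣ xs uxs) ⟩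
  suc (length xs)    ∎
  where open ≡-Reasoning

record Selection {n} (m : ℕ) (p : Subset n) : Set where
  constructor selection
  field
    points   : List (Fin n)
    distinct : Unique points
    inside   : All (_∈ p) points
    count    : length points ≡ m

select : ∀ {n} m (p : Subset n) → m ≤ ∣ p ∣ → Selection m p
select zero    p            _         = selection [] [] [] refl
select (suc m) (true ∷ p)  (s≤s m≤p) = take-first (select m p m≤p)
  where
  take-first : Selection m p → Selection (suc m) (true ∷ p)
  take-first (selection xs u xs⊆p len) =
    selection (Fin.zero ∷ map Fin.suc xs)
      (unique-∷ zero∉ (Unique.map⁺ Fin.suc-injective u))
      (here ∷ map⁺ (All.map there xs⊆p))
      (cong suc (trans (length-map Fin.suc xs) len))
    where
    zero∉ : ∀ {ys : List (Fin _)} → Fin.zero ∉ₗ map Fin.suc ys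
    zero∉ {_ ∷ ys} (Any.there z∈) = zero∉ {ys} z∈
select (suc m) (false ∷ p) m≤p       = skip-first (select (suc m) p m≤p)
  where
  skip-first : Selection (suc m) p → Selection (suc m) (false ∷ p)
  skip-first (selection xs u xs⊆p len) =
    selection (map Fin.suc xs) (Unique.map⁺ Fin.suc-injective u)
      (map⁺ (All.map there xs⊆p)) (trans (length-map Fin.suc xs) len)

select-outside : ∀ {n} m (A : Subset n) → m + ∣ A ∣ ≤ n → Selection m (∁ A)
select-outside {n} m A room = select m (∁ A) (begin
  m            ≤⟨ m+n≤o⇒m≤o∸n m room ⟩
  n ∸ ∣ A ∣    ≡⟨ sym (∣∁p∣≡n∸∣p∣ A) ⟩
  ∣ ∁ A ∣      ∎)
  where open ≤-Reasoning

Differ : ∀ {n} → Subset n → Subset n → Set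
Differ U W = ∃ λ x → (x ∈ U × x ∉ W) ⊎ (x ∈ W × x ∉ U)

differ-∷ : ∀ {n b c} {U W : Subset n} → Differ U W → Differ (b ∷ U) (c ∷ W)
differ-∷ (x , inj₁ (x∈U , x∉W)) = Fin.suc x , inj₁ (there x∈U , λ { (there x∈W) → x∉W x∈W })
differ-∷ (x , inj₂ (x∈W , x∉U)) = Fin.suc x , inj₂ (there x∈W , λ { (there x∈U) → x∉U x∈U })

difference : ∀ {n} (U W : Subset n) → U ≢ W → Differ U W
difference []          []          U≢W = contradiction refl U≢W
difference (true ∷ U)  (false ∷ W) _   = Fin.zero , inj₁ (here , λ ())
difference (false ∷ U) (true ∷ W)  _   = Fin.zero , inj₂ (here , λ ())
difference (true ∷ U)  (true ∷ W)  U≢W = differ-∷ (difference U W (λ U≡W → U≢W (cong (true ∷_) U≡W)))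
difference (false ∷ U) (false ∷ W) U≢W = differ-∷ (difference U W (λ U≡W → U≢W (cong (false ∷_) U≡W)))

walk₀⇒≡ : ∀ {n k} {U X : Subset n} → Walk k U X 0 → U ≡ X
walk₀⇒≡ here = refl

walk₁⇒disjoint : ∀ {n k} {U X : Subset n} → Walk k U X 1 → Empty (U ∩ X)
walk₁⇒disjoint (step (_ , _ , U∩X≡∅) here) = U∩X≡∅

-- When 3k ≤ n, any two k-sets are at distance 0, 1 or 2 in K(n,k): a k-set V
-- avoiding U ∪ X is a common neighbour of U and X.
distance-exists : ∀ {n} k → k + (k + k) ≤ n → (U X : Subset n) →
  IsKSubset k U → IsKSubset k X → ∃ λ d → Dist k U X d
distance-exists {n} k room U X ∣U∣≡k ∣X∣≡k with ≡-dec Bool._≟_ U X | nonempty? (U ∩ X)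
... | yes refl | _ = 0 , here , λ _ ()
... | no U≢X | no U∩X≡∅ =
  1 , step (∣U∣≡k , ∣X∣≡k , U∩X≡∅) here ,
  λ { zero _ w → U≢X (walk₀⇒≡ w) ; (suc _) (s≤s ()) _ }
... | no U≢X | yes U∩X≢∅ =
  2 , step (∣U∣≡k , ∣V∣≡k , U∩V≡∅) (step (∣V∣≡k , ∣X∣≡k , V∩X≡∅) here) ,
  λ { zero _ w → U≢X (walk₀⇒≡ w) ; 1 _ w → walk₁⇒disjoint w U∩X≢∅
    ; (suc (suc _)) (s≤s (s≤s ())) _ }
  where
  ∣U∪X∣≤k+k : ∣ U ∪ X ∣ ≤ k + k
  ∣U∪X∣≤k+k = ≤-trans (∣p∪q∣≤∣p∣+∣q∣ U X) (≤-reflexive (cong₂ _+_ ∣U∣≡k ∣X∣≡k))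
  open Selection (select-outside k (U ∪ X) (≤-trans (+-monoʳ-≤ k ∣U∪X∣≤k+k) room))
  V : Subset n
  V = ⟦ points ⟧
  ∣V∣≡k : IsKSubset k V
  ∣V∣≡k = trans (∣⟦⟧∣ points distinct) count
  V-avoids : ∀ {z} → z ∈ V → z ∉ U ∪ X
  V-avoids z∈V = x∈∁p⇒x∉p (All.lookup inside (∈⟦⟧⁻ points z∈V))
  U∩V≡∅ : Empty (U ∩ V)
  U∩V≡∅ (z , z∈) = let (z∈U , z∈V) = x∈p∩q⁻ U V z∈ in V-avoids z∈V (x∈p∪q⁺ (inj₁ z∈U))
  V∩X≡∅ : Empty (V ∩ X)
  V∩X≡∅ (z , z∈) = let (z∈V , z∈X) = x∈p∩q⁻ V X z∈ in V-avoids z∈V (x∈p∪q⁺ (inj₂ z∈X))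

disjoint⇒distance₁ : ∀ {n k d} {U X : Subset n} → 1 ≤ k →
  IsKSubset k U → IsKSubset k X → Empty (U ∩ X) → Dist k U X d → d ≡ 1
disjoint⇒distance₁ {n} {d = zero} {U} 1≤k ∣U∣≡k _ U∩X≡∅ (w , _) with walk₀⇒≡ w
... | refl = contradiction (begin
    1          ≤⟨ 1≤k ⟩
    _          ≡⟨ sym ∣U∣≡k ⟩
    ∣ U ∣      ≡⟨ cong ∣_∣ (Empty-unique (subst Empty (∩-idem U) U∩X≡∅)) ⟩
    ∣ ∅ {n} ∣  ≡⟨ ∣⊥∣≡0 n ⟩
    0          ∎) λ ()
  where open ≤-Reasoning
disjoint⇒distance₁ {d = 1} _ _ _ _ _ = refl
disjoint⇒distance₁ {d = suc (suc d)} _ ∣U∣≡k ∣X∣≡k U∩X≡∅ (_ , minimal) =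
  ⊥-elim (minimal 1 (s≤s (s≤s z≤n)) (step (∣U∣≡k , ∣X∣≡k , U∩X≡∅) here))

meeting⇒distance≢1 : ∀ {n k d} {U X : Subset n} → Nonempty (U ∩ X) → Dist k U X d → d ≢ 1
meeting⇒distance≢1 U∩X≢∅ (w , _) refl = walk₁⇒disjoint w U∩X≢∅

-- Arithmetic for `separating-block` below: with k = 3 + j, the j points and
-- then the k + 1 points it selects fit among 3k points.
room-for-rest : ∀ j → j + ((3 + j) + 1) + ((3 + j) + 2) ≡ (3 + j) + ((3 + j) + (3 + j))
room-for-rest = solve-∀

room-for-ys : ∀ j → suc (3 + j) + ((3 + j) + suc j) + 1 ≡ (3 + j) + ((3 + j) + (3 + j))
room-for-ys = solve-∀

module Separation {n j : ℕ} {B : List (Subset n)} (steiner : IsSteiner (2 + j) (3 + j) n B) where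
  open IsSteiner steiner

  private
    k : ℕ
    k = 3 + j

  -- The block through a (k-1)-set T (an arbitrary value on other sets).
  blockThrough : Subset n → Subset n
  blockThrough T with ∣ T ∣ ≟ 2 + j
  ... | yes ∣T∣≡k-1 = proj₁ (covers T ∣T∣≡k-1)
  ... | no _        = ∅

  blockThrough-spec : ∀ T → IsKSubset (2 + j) T → blockThrough T ∈ₗ B × T ⊆ blockThrough T
  blockThrough-spec T ∣T∣≡k-1 with ∣ T ∣ ≟ 2 + j
  ... | yes ∣T∣≡k-1′ = proj₂ (covers T ∣T∣≡k-1′)
  ... | no ∣T∣≢k-1   = contradiction ∣T∣≡k-1 ∣T∣≢k-1

  -- Two blocks through S ∪ {y}, S ∪ {y'} cannot share
  -- a point w of W: both would be the block through S ∪ {w}, which would then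
  -- hold the k+1 points y, y', w, S.  By pigeonhole one of them misses W.
  block-missing : ∀ (W : Subset n) → IsKSubset k W →
    (S : List (Fin n)) → Unique S → length S ≡ suc j → All (_∉ W) S →
    (ys : List (Fin n)) → Unique ys → length ys ≡ suc k → All (λ y → y ∉ W × y ∉ₗ S) ys →
    ∃ λ X → X ∈ₗ B × All (_∈ X) S × Empty (W ∩ X)
  block-missing W ∣W∣≡k S uS ∣S∣ S∉W ys uys ∣ys∣ ys-fresh =
    conclude (any? (λ y → ¬? (nonempty? (W ∩ X y))) ys)
    where
    X : Fin n → Subset n
    X y = blockThrough ⟦ y ∷ S ⟧

    ∣S∪v∣ : ∀ v → v ∉ₗ S → IsKSubset (2 + j) ⟦ v ∷ S ⟧
    ∣S∪v∣ v v∉S = trans (∣⟦⟧∣ (v ∷ S) (unique-∷ v∉S uS)) (cong suc ∣S∣)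

    X-spec : ∀ {y} → y ∈ₗ ys → X y ∈ₗ B × ⟦ y ∷ S ⟧ ⊆ X y
    X-spec {y} y∈ys = blockThrough-spec ⟦ y ∷ S ⟧ (∣S∪v∣ y (proj₂ (All.lookup ys-fresh y∈ys)))

    separated : ∀ {y y' w} → y ∈ₗ ys → y' ∈ₗ ys → y ≢ y' → w ∈ W → w ∈ X y → w ∈ X y' → ⊥
    separated {y} {y'} {w} y∈ys y'∈ys y≢y' w∈W w∈Xy w∈Xy' = 1+n≰n (begin-strict
      k                          <⟨ s≤s (≤-reflexive (cong (λ m → suc (suc m)) (sym ∣S∣))) ⟩
      length (y ∷ y' ∷ w ∷ S)    ≤⟨ distinct-length≤ (y ∷ y' ∷ w ∷ S) distinct-points points⊆Xy ⟩
      ∣ X y ∣                    ≡⟨ All.lookup blockSize (proj₁ (X-spec y∈ys)) ⟩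
      k                          ∎)
      where
      open ≤-Reasoning
      y∉W : y ∉ W
      y∉W = proj₁ (All.lookup ys-fresh y∈ys)
      y∉S : y ∉ₗ S
      y∉S = proj₂ (All.lookup ys-fresh y∈ys)
      y'∉W : y' ∉ W
      y'∉W = proj₁ (All.lookup ys-fresh y'∈ys)
      y'∉S : y' ∉ₗ S
      y'∉S = proj₂ (All.lookup ys-fresh y'∈ys)
      w∉S : w ∉ₗ S
      w∉S w∈S = All.lookup S∉W w∈S w∈W
      S∪w⊆ : ∀ {v} → v ∈ₗ ys → w ∈ X v → ⟦ w ∷ S ⟧ ⊆ X v
      S∪w⊆ {v} v∈ys w∈Xv z∈ with ∈⟦⟧⁻ (w ∷ S) z∈
      ... | Any.here refl  = w∈Xv
      ... | Any.there z∈S = proj₂ (X-spec v∈ys) (∈⟦⟧⁺ (v ∷ S) (Any.there z∈S))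
      Xy≡Xy' : X y ≡ X y'
      Xy≡Xy' = unique ⟦ w ∷ S ⟧ (∣S∪v∣ w w∉S) (X y) (X y')
                 (proj₁ (X-spec y∈ys)) (proj₁ (X-spec y'∈ys)) (S∪w⊆ y∈ys w∈Xy) (S∪w⊆ y'∈ys w∈Xy')
      distinct-points : Unique (y ∷ y' ∷ w ∷ S)
      distinct-points =
        unique-∷ (λ { (Any.here y≡y') → y≢y' y≡y'
                    ; (Any.there (Any.here refl)) → y∉W w∈W
                    ; (Any.there (Any.there y∈S)) → y∉S y∈S })
        (unique-∷ (λ { (Any.here refl) → y'∉W w∈W ; (Any.there y'∈S) → y'∉S y'∈S })
        (unique-∷ w∉S uS))
      points⊆Xy : All (_∈ X y) (y ∷ y' ∷ w ∷ S)
      points⊆Xy =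
        proj₂ (X-spec y∈ys) (∈⟦⟧⁺ (y ∷ S) (Any.here refl))
        ∷ subst (y' ∈_) (sym Xy≡Xy') (proj₂ (X-spec y'∈ys) (∈⟦⟧⁺ (y' ∷ S) (Any.here refl)))
        ∷ w∈Xy
        ∷ All.tabulate (λ z∈S → proj₂ (X-spec y∈ys) (∈⟦⟧⁺ (y ∷ S) (Any.there z∈S)))

    conclude : Dec (Any (λ y → Empty (W ∩ X y)) ys) → ∃ λ X → X ∈ₗ B × All (_∈ X) S × Empty (W ∩ X)
    conclude (yes some-misses) =
      let (y , y∈ys , misses) = find some-misses
      in X y , proj₁ (X-spec y∈ys) ,
         All.tabulate (λ z∈S → proj₂ (X-spec y∈ys) (∈⟦⟧⁺ (y ∷ S) (Any.there z∈S))) , misses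
    conclude (no none-misses)  = contradiction (begin
      suc k      ≡⟨ sym ∣ys∣ ⟩
      length ys  ≤⟨ traces-bound X W ys uys all-meet separated ⟩
      ∣ W ∣      ≡⟨ ∣W∣≡k ⟩
      k          ∎) (1+n≰n {k})
      where
      open ≤-Reasoning
      all-meet : All (λ y → Nonempty (W ∩ X y)) ys
      all-meet = All.map (λ {y} ¬empty → decidable-stable (nonempty? (W ∩ X y)) ¬empty)
                         (¬Any⇒All¬ ys none-misses)

  -- Take S = {x} plus j points outside
  -- W ∪ {x}, and k+1 further points outside W ∪ S, then apply block-missing.
  separating-block : k + (k + k) ≤ n → ∀ (W : Subset n) x → IsKSubset k W → x ∉ W →
    ∃ λ X → X ∈ₗ B × x ∈ X × Empty (W ∩ X)
  separating-block room W x ∣W∣≡k x∉W =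
    let (X , X∈B , S⊆X , misses) = block-missing W ∣W∣≡k S uS ∣S∣ S∉W
                                     Ys.points Ys.distinct Ys.count ys-fresh
    in X , X∈B , All.lookup S⊆X (Any.here refl) , misses
    where
    open ≤-Reasoning
    module Rest = Selection (select-outside j (W ∪ ⁅ x ⁆) (≤-trans (+-monoʳ-≤ j (begin
      ∣ W ∪ ⁅ x ⁆ ∣        ≤⟨ ∣p∪q∣≤∣p∣+∣q∣ W ⁅ x ⁆ ⟩
      ∣ W ∣ + ∣ ⁅ x ⁆ ∣    ≡⟨ cong₂ _+_ ∣W∣≡k (∣⁅x⁆∣≡1 x) ⟩
      k + 1                ∎)) (begin
      j + (k + 1)                   ≤⟨ m≤m+n _ (k + 2) ⟩
      j + (k + 1) + (k + 2)         ≡⟨ room-for-rest j ⟩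
      k + (k + k)                   ≤⟨ room ⟩
      n                             ∎)))
    rest-outside : ∀ {z} → z ∈ₗ Rest.points → z ∉ W ∪ ⁅ x ⁆
    rest-outside z∈ = x∈∁p⇒x∉p (All.lookup Rest.inside z∈)
    S : List (Fin n)
    S = x ∷ Rest.points
    uS : Unique S
    uS = unique-∷ (λ x∈rest → rest-outside x∈rest (x∈p∪q⁺ (inj₂ (x∈⁅x⁆ x)))) Rest.distinct
    ∣S∣ : length S ≡ suc j
    ∣S∣ = cong suc Rest.count
    S∉W : All (_∉ W) S
    S∉W = x∉W ∷ All.tabulate (λ z∈ z∈W → rest-outside z∈ (x∈p∪q⁺ (inj₁ z∈W)))
    module Ys = Selection (select-outside (suc k) (W ∪ ⟦ S ⟧) (≤-trans (+-monoʳ-≤ (suc k) (begin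
      ∣ W ∪ ⟦ S ⟧ ∣        ≤⟨ ∣p∪q∣≤∣p∣+∣q∣ W ⟦ S ⟧ ⟩
      ∣ W ∣ + ∣ ⟦ S ⟧ ∣    ≡⟨ cong₂ _+_ ∣W∣≡k (trans (∣⟦⟧∣ S uS) ∣S∣) ⟩
      k + suc j            ∎)) (begin
      suc k + (k + suc j)           ≤⟨ m≤m+n _ 1 ⟩
      suc k + (k + suc j) + 1       ≡⟨ room-for-ys j ⟩
      k + (k + k)                   ≤⟨ room ⟩
      n                             ∎)))
    ys-fresh : All (λ y → y ∉ W × y ∉ₗ S) Ys.points
    ys-fresh = All.map (λ y∈∁ → let y∉ = x∈∁p⇒x∉p y∈∁ in
                         (λ y∈W → y∉ (x∈p∪q⁺ (inj₁ y∈W))) , (λ y∈S → y∉ (x∈p∪q⁺ (inj₂ (∈⟦⟧⁺ S y∈S)))))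
                       Ys.inside

-- Blocks resolve K(n,k) (k = 3 + j, 3k ≤ n).  Given x ∈ U \ W, take a block X
-- through x missing W: then d(W,X) = 1, while d(U,X) ≠ 1 because U meets X.
module Resolution {n j : ℕ} {B : List (Subset n)} (steiner : IsSteiner (2 + j) (3 + j) n B)
                  (room : (3 + j) + ((3 + j) + (3 + j)) ≤ n) where
  open IsSteiner steiner
  open Separation steiner using (separating-block)

  private
    k : ℕ
    k = 3 + j

  distinguished : ∀ {U W : Subset n} {x} → IsKSubset k U → IsKSubset k W → x ∈ U → x ∉ W →
    ∃ λ X → X ∈ₗ B × ∃ λ a → ∃ λ b → Dist k U X a × Dist k W X b × a ≢ b
  distinguished {U} {W} {x} ∣U∣≡k ∣W∣≡k x∈U x∉W =
    let (X , X∈B , x∈X , W∩X≡∅) = separating-block room W x ∣W∣≡k x∉W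
        ∣X∣≡k     = All.lookup blockSize X∈B
        (a , dUX) = distance-exists k room U X ∣U∣≡k ∣X∣≡k
        (b , dWX) = distance-exists k room W X ∣W∣≡k ∣X∣≡k
        b≡1       = disjoint⇒distance₁ (s≤s z≤n) ∣W∣≡k ∣X∣≡k W∩X≡∅ dWX
        a≢1       = meeting⇒distance≢1 (x , x∈p∩q⁺ (x∈U , x∈X)) dUX
    in X , X∈B , a , b , dUX , dWX , λ a≡b → a≢1 (trans a≡b b≡1)

  blocks-resolve : IsResolving k B
  blocks-resolve = distinct , blockSize , resolve
    where
    resolve : ∀ (U W : Subset n) → IsKSubset k U → IsKSubset k W → U ≢ W →
      ∃ λ X → X ∈ₗ B × ∃ λ a → ∃ λ b → Dist k U X a × Dist k W X b × a ≢ b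
    resolve U W ∣U∣≡k ∣W∣≡k U≢W with difference U W U≢W
    ... | x , inj₁ (x∈U , x∉W) = distinguished ∣U∣≡k ∣W∣≡k x∈U x∉W
    ... | x , inj₂ (x∈W , x∉U) =
      let (X , X∈B , b , a , dWX , dUX , b≢a) = distinguished ∣W∣≡k ∣U∣≡k x∈W x∉U
      in X , X∈B , a , b , dUX , dWX , ≢-sym b≢a

-- A family of subsets of [1+n] splits into
-- the families `slice false` / `slice true` of those avoiding / containing the
-- first point, each restricted to the remaining n points.
slice : ∀ {n} → Bool → List (Subset (suc n)) → List (Subset n)
slice b [] = []
slice b ((c ∷ s) ∷ L) with c Bool.≟ b
... | yes _ = s ∷ slice b L
... | no _  = slice b L

slice-∈ : ∀ {n} b (L : List (Subset (suc n))) {s} → s ∈ₗ slice b L → (b ∷ s) ∈ₗ L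
slice-∈ b ((c ∷ s) ∷ L) s∈ with c Bool.≟ b | s∈
... | yes refl | Any.here refl  = Any.here refl
... | yes refl | Any.there s∈L = Any.there (slice-∈ b L s∈L)
... | no _     | s∈L           = Any.there (slice-∈ b L s∈L)

slice-unique : ∀ {n} b (L : List (Subset (suc n))) → Unique L → Unique (slice b L)
slice-unique b [] _ = []
slice-unique b ((c ∷ s) ∷ L) u@(_ ∷ uL) with c Bool.≟ b
... | yes refl = unique-∷ (λ s∈ → unique-head u (slice-∈ b L s∈)) (slice-unique b L uL)
... | no _     = slice-unique b L uL

slice-size : ∀ {n j} b (L : List (Subset (suc n))) →
  All (IsKSubset j) L → All (λ s → ∣ b ∷ s ∣ ≡ j) (slice b L)
slice-size b [] [] = []
slice-size b ((c ∷ s) ∷ L) (∣cs∣≡j ∷ sizes) with c Bool.≟ b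
... | yes refl = ∣cs∣≡j ∷ slice-size b L sizes
... | no _     = slice-size b L sizes

slice-length : ∀ {n} (L : List (Subset (suc n))) →
  length L ≡ length (slice false L) + length (slice true L)
slice-length [] = refl
slice-length ((false ∷ s) ∷ L) = cong suc (slice-length L)
slice-length ((true ∷ s) ∷ L)  =
  trans (cong suc (slice-length L)) (sym (+-suc (length (slice false L)) (length (slice true L))))

family-bound : ∀ n j (L : List (Subset n)) → Unique L → All (IsKSubset j) L → length L ≤ n C j
family-bound zero    j       []               _ _          = z≤n
family-bound zero    zero    ([] ∷ [])        _ _          = ≤-refl
family-bound zero    zero    ([] ∷ [] ∷ _)    u _          = contradiction (Any.here refl) (unique-head u)
family-bound zero    (suc j) ([] ∷ _)         _ (() ∷ _)
family-bound (suc n) zero    L                u sizes      = begin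
  length L                                        ≡⟨ slice-length L ⟩
  length (slice false L) + length (slice true L)  ≡⟨ cong (length (slice false L) +_) no-inside ⟩
  length (slice false L) + 0                      ≡⟨ +-identityʳ _ ⟩
  length (slice false L)                          ≤⟨ family-bound n zero (slice false L)
                                                       (slice-unique false L u) (slice-size false L sizes) ⟩
  n C 0                                           ∎
  where
  open ≤-Reasoning
  -- No 0-subset contains the first point.
  empty : ∀ (M : List (Subset n)) → All (λ s → ∣ true ∷ s ∣ ≡ 0) M → length M ≡ 0
  empty [] [] = refl
  no-inside : length (slice true L) ≡ 0
  no-inside = empty (slice true L) (slice-size true L sizes)
family-bound (suc n) (suc j) L                u sizes      = begin
  length L                                        ≡⟨ slice-length L ⟩
  length (slice false L) + length (slice true L)  ≤⟨ +-mono-≤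
    (family-bound n (suc j) (slice false L) (slice-unique false L u) (slice-size false L sizes))
    (family-bound n j (slice true L) (slice-unique true L u)
      (All.map suc-injective (slice-size true L sizes))) ⟩
  n C suc j + n C j                               ≡⟨ +-comm (n C suc j) (n C j) ⟩
  n C j + n C suc j                               ≡⟨ nCk+nC[k+1]≡[n+1]C[k+1] n j ⟩
  suc n C suc j                                   ∎
  where open ≤-Reasoning

shadow : ∀ {n} → Subset n → List (Subset n)
shadow []          = []
shadow (true ∷ s)  = (false ∷ s) ∷ map (true ∷_) (shadow s)
shadow (false ∷ s) = map (false ∷_) (shadow s)

shadow-length : ∀ {n} (X : Subset n) → length (shadow X) ≡ ∣ X ∣
shadow-length []          = refl
shadow-length (true ∷ s)  = cong suc (trans (length-map (true ∷_) (shadow s)) (shadow-length s))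
shadow-length (false ∷ s) = trans (length-map (false ∷_) (shadow s)) (shadow-length s)

extend : ∀ {n} b {r s : Subset n} → r ⊆ s × suc ∣ r ∣ ≡ ∣ s ∣ →
  (b ∷ r) ⊆ (b ∷ s) × suc ∣ b ∷ r ∣ ≡ ∣ b ∷ s ∣
extend true  (r⊆s , ∣r∣) = s⊆s r⊆s , cong suc ∣r∣
extend false (r⊆s , ∣r∣) = s⊆s r⊆s , ∣r∣

shadow-member : ∀ {n} (X : Subset n) → All (λ r → r ⊆ X × suc ∣ r ∣ ≡ ∣ X ∣) (shadow X)
shadow-member []          = []
shadow-member (true ∷ s)  = (out⊆ ⊆-refl , refl) ∷ map⁺ (All.map (extend true) (shadow-member s))
shadow-member (false ∷ s) = map⁺ (All.map (extend false) (shadow-member s))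

shadow-unique : ∀ {n} (X : Subset n) → Unique (shadow X)
shadow-unique []          = []
shadow-unique (true ∷ s)  =
  unique-∷ (false∉ (shadow s)) (Unique.map⁺ ∷-injectiveʳ (shadow-unique s))
  where
  false∉ : ∀ rs → (false ∷ s) ∉ₗ map (true ∷_) rs
  false∉ (_ ∷ rs) (Any.there s∈) = false∉ rs s∈
shadow-unique (false ∷ s) = Unique.map⁺ ∷-injectiveʳ (shadow-unique s)

concatMap-length : ∀ {A C : Set} (f : A → List C) m (xs : List A) →
  All (λ x → length (f x) ≡ m) xs → length (concatMap f xs) ≡ m * length xs
concatMap-length f m []       []       = sym (*-zeroʳ m)
concatMap-length f m (x ∷ xs) (∣fx∣ ∷ ∣fxs∣) = begin
  length (f x ++ concatMap f xs)          ≡⟨ length-++ (f x) ⟩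
  length (f x) + length (concatMap f xs)  ≡⟨ cong₂ _+_ ∣fx∣ (concatMap-length f m xs ∣fxs∣) ⟩
  m + m * length xs                       ≡⟨ sym (*-suc m (length xs)) ⟩
  m * suc (length xs)                     ∎
  where open ≡-Reasoning

concatMap-unique : ∀ {A C : Set} (f : A → List C) (xs : List A) → Unique xs →
  All (λ x → Unique (f x)) xs →
  (∀ {x x' c} → x ∈ₗ xs → x' ∈ₗ xs → c ∈ₗ f x → c ∈ₗ f x' → x ≡ x') →
  Unique (concatMap f xs)
concatMap-unique f []       _              _             _    = []
concatMap-unique f (x ∷ xs) u@(_ ∷ uxs) (ufx ∷ ufxs) same =
  Unique.++⁺ ufx (concatMap-unique f xs uxs ufxs (λ x∈ x'∈ → same (Any.there x∈) (Any.there x'∈)))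
    λ (c∈fx , c∈rest) →
      let (x' , x'∈xs , c∈fx') = find (∈-concatMap⁻ f c∈rest)
      in unique-head u (subst (_∈ₗ xs) (sym (same (Any.here refl) (Any.there x'∈xs) c∈fx c∈fx')) x'∈xs)

-- Counting bound for Steiner systems S(t,t+1,n): each block contains t+1
-- t-sets (its shadow) and no t-set lies in two blocks, so (t+1)·|B| ≤ C(n,t).
steiner-bound : ∀ {t n B} → IsSteiner t (suc t) n B → suc t * length B ≤ n C t
steiner-bound {t} {n} {B} steiner = begin
  suc t * length B              ≡⟨ sym (concatMap-length shadow (suc t) B
                                     (All.map (λ {X} ∣X∣ → trans (shadow-length X) ∣X∣) blockSize)) ⟩
  length (concatMap shadow B)   ≤⟨ family-bound n t (concatMap shadow B)
                                     (concatMap-unique shadow B distinct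
                                       (All.tabulate (λ {X} _ → shadow-unique X)) same-block)
                                     all-t-sets ⟩
  n C t                         ∎
  where
  open ≤-Reasoning
  open IsSteiner steiner
  shadow-of-block : ∀ {X r} → X ∈ₗ B → r ∈ₗ shadow X → r ⊆ X × IsKSubset t r
  shadow-of-block {X} X∈B r∈ =
    let (r⊆X , ∣r∣) = All.lookup (shadow-member X) r∈
    in r⊆X , suc-injective (trans ∣r∣ (All.lookup blockSize X∈B))
  same-block : ∀ {X X' r} → X ∈ₗ B → X' ∈ₗ B → r ∈ₗ shadow X → r ∈ₗ shadow X' → X ≡ X'
  same-block X∈B X'∈B r∈ r∈' =
    let (r⊆X , ∣r∣) = shadow-of-block X∈B r∈
    in unique _ ∣r∣ _ _ X∈B X'∈B r⊆X (proj₁ (shadow-of-block X'∈B r∈'))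
  all-t-sets : All (IsKSubset t) (concatMap shadow B)
  all-t-sets = All.tabulate λ r∈ →
    let (X , X∈B , r∈shadow) = find (∈-concatMap⁻ shadow r∈)
    in proj₂ (shadow-of-block X∈B r∈shadow)

-- For k = 3 + j the hypothesis n ≥ 4k - 2 leaves room for 3k points
-- (4k ∸ 2 unfolds to 1 + (j + 3k)).
3k≤4k-2 : ∀ j → (3 + j) + ((3 + j) + (3 + j)) ≤ 4 * (3 + j) ∸ 2
3k≤4k-2 j = ≤-trans (m≤m+n _ (1 + j)) (≤-reflexive (padding j))
  where
  padding : ∀ j → (3 + j) + ((3 + j) + (3 + j)) + (1 + j) ≡ 1 + (j + 3 * (3 + j))
  padding = solve-∀

theorem4p5 : ∀ (k n : ℕ) → 3 ≤ k → 4 * k ∸ 2 ≤ n →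
    ∀ (B : List (Subset n)) → IsSteiner (k ∸ 1) k n B →
    IsResolving k B × (∀ b → IsMetricDim n k b → k * b ≤ n C (k ∸ 1))
theorem4p5 k@(suc (suc (suc j))) n (s≤s (s≤s (s≤s z≤n))) 4k-2≤n B steiner =
  blocks-resolve , λ b (_ , minimum) → begin
    k * b          ≤⟨ *-monoʳ-≤ k (minimum B blocks-resolve) ⟩
    k * length B   ≤⟨ steiner-bound steiner ⟩
    n C (k ∸ 1)    ∎
  where
  open ≤-Reasoning
  open Resolution steiner (≤-trans (3k≤4k-2 j) 4k-2≤n) using (blocks-resolve)
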